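{- For every integer $n \geq 4$, the product of all primes $p$ with $n < p < n^2$ is at least $n!\,2^n$. -}

module Defs where

open import Data.Nat using (ℕ; suc; _+_; _∸_)
open import Data.List using (List; filter; upTo; map)
open import Data.Nat.ListAction using (product)
open import Data.Nat.Primality using (prime?)

openInterval : ℕ → ℕ → List ℕ
openInterval a b = map (λ i → suc a + i) (upTo (b ∸ suc a))

primeProductBetween : ℕ → ℕ → ℕ
primeProductBetween a b = product (filter prime? (openInterval a b))

-- Let M = n!³ · ∏_{n<p<n²} p. Every 0 < k < n² divides M: splitting off the greatest divisor
-- d ≤ n of k, either k is a product of three numbers ≤ n, or k = a · p with a ≤ n and p a prime
-- in (n, n²). So M is a common multiple of m+1, …, 2m+1 whenever 2m+2 ≤ n², and every such
-- common multiple is divisible by (2m+1)!/(m!)², which is at least 4^m. Choosing m with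
-- n² ≤ 2m+3, the estimate 8 · 2^n · n!⁴ ≤ 2^(n²) (valid for n ≥ 11) gives n!³ · n! · 2^n ≤ M;
-- the cases 4 ≤ n ≤ 10 are decided by computation.
module Submission where

open import Data.List using ([]; _∷_)
open import Data.List.Membership.Propositional using (_∈_)
open import Data.List.Membership.Propositional.Properties using (∈-filter⁺; ∈-map⁺; ∈-upTo⁺)
open import Data.List.Relation.Unary.All using (_∷_)
open import Data.List.Relation.Unary.All.Properties using (all-filter)
open import Data.Nat
open import Data.Nat.Combinatorics using (k![n∸k]!∣n!)
open import Data.Nat.Divisibility
open import Data.Nat.ListAction using (product)
open import Data.Nat.ListAction.Properties using (∈⇒∣product)
open import Data.Nat.Primality
open import Data.Nat.Primality.Factorisation using (factorise)
open import Data.Nat.Properties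
open import Algebra.Properties.CommutativeSemigroup *-commutativeSemigroup
  using (x∙yz≈y∙xz; x∙yz≈yx∙z; xy∙z≈y∙zx; xy∙z≈zx∙y; xy∙z≈yz∙x)
open import Data.Nat.Tactic.RingSolver using (solve-∀)
open import Data.Product using (∃-syntax; ∃₂; _×_; _,_)
open import Data.Sum using (inj₁; inj₂)
open import Data.Unit using (tt)
open import Relation.Binary.PropositionalEquality
open import Relation.Nullary using (Dec; yes; no; contradiction)

open import Defs

a!b!∣[1+a+b]! : ∀ a b → a ! * b ! ∣ suc (a + b) !
a!b!∣[1+a+b]! a b = ∣-trans a!b!∣[a+b]! (m≤n⇒m!∣n! (n≤1+n (a + b)))
  where
  a!b!∣[a+b]! : a ! * b ! ∣ (a + b) !
  a!b!∣[a+b]! = subst (λ c → a ! * c ! ∣ (a + b) !) (m+n∸m≡n a b) (k![n∸k]!∣n! (m≤m+n a b))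

factorialQuotient : ℕ → ℕ → ℕ
factorialQuotient a b = quotient (a!b!∣[1+a+b]! a b)

factorialQuotient-spec : ∀ a b → suc (a + b) ! ≡ factorialQuotient a b * (a ! * b !)
factorialQuotient-spec a b = m∣n⇒n≡quotient*m (a!b!∣[1+a+b]! a b)

factorialQuotient≢0 : ∀ a b → NonZero (factorialQuotient a b)
factorialQuotient≢0 a b = quotient≢0 (a!b!∣[1+a+b]! a b) {{suc (a + b) !≢0}}

factorialQuotient-zeroʳ : ∀ a → factorialQuotient a 0 ≡ suc a
factorialQuotient-zeroʳ a = *-cancelʳ-≡ _ _ (a ! * 1) {{a !* 0 !≢0}} (begin
  factorialQuotient a 0 * (a ! * 1) ≡⟨ factorialQuotient-spec a 0 ⟨
  suc (a + 0) !                     ≡⟨ cong (λ c → suc c !) (+-identityʳ a) ⟩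
  suc a * a !                       ≡⟨ cong (suc a *_) (*-identityʳ (a !)) ⟨
  suc a * (a ! * 1)                 ∎)
  where open ≡-Reasoning

factorialQuotient-sucˡ : ∀ a b →
  suc a * factorialQuotient (suc a) b ≡ suc (suc (a + b)) * factorialQuotient a b
factorialQuotient-sucˡ a b = *-cancelʳ-≡ _ _ (a ! * b !) {{a !* b !≢0}} (begin
  suc a * Q′ * (a ! * b !)             ≡⟨ rearrange (suc a) Q′ (a !) (b !) ⟩
  Q′ * (suc a ! * b !)                 ≡⟨ factorialQuotient-spec (suc a) b ⟨
  suc (suc (a + b)) !                  ≡⟨ cong (suc (suc (a + b)) *_) (factorialQuotient-spec a b) ⟩
  suc (suc (a + b)) * (Q * (a ! * b !)) ≡⟨ *-assoc (suc (suc (a + b))) Q (a ! * b !) ⟨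
  suc (suc (a + b)) * Q * (a ! * b !)  ∎)
  where
  open ≡-Reasoning
  Q Q′ : ℕ
  Q  = factorialQuotient a b
  Q′ = factorialQuotient (suc a) b
  rearrange : ∀ s q f g → s * q * (f * g) ≡ q * (s * f * g)
  rearrange = solve-∀

factorialQuotient-sucʳ : ∀ a b →
  suc b * factorialQuotient a (suc b) ≡ suc (suc (a + b)) * factorialQuotient a b
factorialQuotient-sucʳ a b = *-cancelʳ-≡ _ _ (a ! * b !) {{a !* b !≢0}} (begin
  suc b * Q′ * (a ! * b !)             ≡⟨ rearrange (suc b) Q′ (a !) (b !) ⟩
  Q′ * (a ! * suc b !)                 ≡⟨ factorialQuotient-spec a (suc b) ⟨
  suc (a + suc b) !                    ≡⟨ cong (λ c → suc c !) (+-suc a b) ⟩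
  suc (suc (a + b)) !                  ≡⟨ cong (suc (suc (a + b)) *_) (factorialQuotient-spec a b) ⟩
  suc (suc (a + b)) * (Q * (a ! * b !)) ≡⟨ *-assoc (suc (suc (a + b))) Q (a ! * b !) ⟨
  suc (suc (a + b)) * Q * (a ! * b !)  ∎)
  where
  open ≡-Reasoning
  Q Q′ : ℕ
  Q  = factorialQuotient a b
  Q′ = factorialQuotient a (suc b)
  rearrange : ∀ s q f g → s * q * (f * g) ≡ q * (f * (s * g))
  rearrange = solve-∀

-- With c = s + t, the hypotheses say 1/z = 1/x − 1/y, so M/z = M/x − M/y.
harmonicDifference-∣ : ∀ {s t x y z M} → .{{NonZero s}} → .{{NonZero t}} → .{{NonZero x}} →
  s * y ≡ (s + t) * x → t * z ≡ (s + t) * x → x ∣ M → y ∣ M → z ∣ M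
harmonicDifference-∣ {s} {t} {x} {y} {z} {M} sy≡cx tz≡cx (divides u M≡ux) (divides v M≡vy) =
  divides (u ∸ v) (*-cancelʳ-≡ M _ (s * t) {{m*n≢0 s t}} (begin
    M * (s * t)               ≡⟨ cong (_* (s * t)) M≡vy ⟩
    v * y * (s * t)           ≡⟨ swap v y s t ⟩
    (t * v) * (s * y)         ≡⟨ cong₂ _*_ s[u∸v]≡tv (trans tz≡cx (sym sy≡cx)) ⟨
    (s * (u ∸ v)) * (t * z)   ≡⟨ swap′ s (u ∸ v) t z ⟩
    (u ∸ v) * z * (s * t)     ∎))
  where
  open ≡-Reasoning
  swap : ∀ v y s t → v * y * (s * t) ≡ (t * v) * (s * y)
  swap = solve-∀
  swap′ : ∀ s w t z → (s * w) * (t * z) ≡ w * z * (s * t)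
  swap′ = solve-∀
  su≡cv : s * u ≡ (s + t) * v
  su≡cv = *-cancelʳ-≡ _ _ x (begin
    s * u * x         ≡⟨ *-assoc s u x ⟩
    s * (u * x)       ≡⟨ cong (s *_) (trans (sym M≡ux) M≡vy) ⟩
    s * (v * y)       ≡⟨ x∙yz≈y∙xz s v y ⟩
    v * (s * y)       ≡⟨ cong (v *_) sy≡cx ⟩
    v * ((s + t) * x) ≡⟨ x∙yz≈yx∙z v (s + t) x ⟩
    (s + t) * v * x   ∎)
  s[u∸v]≡tv : s * (u ∸ v) ≡ t * v
  s[u∸v]≡tv = begin
    s * (u ∸ v)           ≡⟨ *-distribˡ-∸ s u v ⟩
    s * u ∸ s * v         ≡⟨ cong (_∸ s * v) (trans su≡cv (*-distribʳ-+ v s t)) ⟩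
    s * v + t * v ∸ s * v ≡⟨ m+n∸m≡n (s * v) (t * v) ⟩
    t * v                 ∎

factorialQuotient-∣ : ∀ a b {M} → (∀ k → a < k → k ≤ suc (a + b) → k ∣ M) →
                      factorialQuotient a b ∣ M
factorialQuotient-∣ a zero     all∣M = subst (_∣ _) (sym (factorialQuotient-zeroʳ a))
                                             (all∣M (suc a) ≤-refl (s≤s (m≤m+n a 0)))
factorialQuotient-∣ a (suc b) all∣M =
  harmonicDifference-∣ {suc a} {suc b} {{_}} {{_}} {{factorialQuotient≢0 a b}}
    (trans (factorialQuotient-sucˡ a b) c≡)
    (trans (factorialQuotient-sucʳ a b) c≡)
    (factorialQuotient-∣ a b λ k a<k k≤ →
       all∣M k a<k (≤-trans (m≤n⇒m≤1+n k≤) (≤-reflexive widen)))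
    (factorialQuotient-∣ (suc a) b λ k a<k k≤ →
       all∣M k (<⇒≤ a<k) (≤-trans k≤ (≤-reflexive widen)))
  where
  c≡ : suc (suc (a + b)) * factorialQuotient a b ≡ (suc a + suc b) * factorialQuotient a b
  c≡ = cong (λ c → suc c * factorialQuotient a b) (sym (+-suc a b))
  widen : suc (suc (a + b)) ≡ suc (a + suc b)
  widen = cong suc (sym (+-suc a b))

4^m≤factorialQuotient : ∀ m → 4 ^ m ≤ factorialQuotient m m
4^m≤factorialQuotient zero    = ≤-reflexive (sym (factorialQuotient-zeroʳ 0))
4^m≤factorialQuotient (suc m) = ≤-trans (*-monoʳ-≤ 4 (4^m≤factorialQuotient m)) 4X≤Z
  where
  open ≤-Reasoning
  X Y Z 2m+2 : ℕ
  X = factorialQuotient m m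
  Y = factorialQuotient (suc m) m
  Z = factorialQuotient (suc m) (suc m)
  2m+2 = suc (suc (m + m))
  square : ∀ m X → (suc m * suc m) * (4 * X) ≡ suc (suc (m + m)) * (suc (suc (m + m)) * X)
  square = solve-∀
  4X≤Z : 4 * X ≤ Z
  4X≤Z = *-cancelˡ-≤ (suc m * suc m) (begin
    (suc m * suc m) * (4 * X)   ≡⟨ square m X ⟩
    2m+2 * (2m+2 * X)           ≤⟨ *-monoˡ-≤ (2m+2 * X) (n≤1+n 2m+2) ⟩
    suc 2m+2 * (2m+2 * X)       ≡⟨ cong (suc 2m+2 *_) (factorialQuotient-sucˡ m m) ⟨
    suc 2m+2 * (suc m * Y)      ≡⟨ x∙yz≈y∙xz (suc 2m+2) (suc m) Y ⟩
    suc m * (suc 2m+2 * Y)      ≡⟨ cong (suc m *_) (factorialQuotient-sucʳ (suc m) m) ⟨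
    suc m * (suc m * Z)         ≡⟨ *-assoc (suc m) (suc m) Z ⟨
    suc m * suc m * Z           ∎)

prime∣primeProductBetween : ∀ {a b p} → Prime p → a < p → p < b → p ∣ primeProductBetween a b
prime∣primeProductBetween {a} {b} {p} p-prime a<p p<b = ∈⇒∣product (∈-filter⁺ prime? p∈ p-prime)
  where
  p∈ : p ∈ openInterval a b
  p∈ = subst (_∈ openInterval a b) (m+[n∸m]≡n a<p)
             (∈-map⁺ (suc a +_) (∈-upTo⁺ (∸-monoˡ-< p<b a<p)))

primeProductBetween≢0 : ∀ a b → NonZero (primeProductBetween a b)
primeProductBetween≢0 a b = productOfPrimes≢0 (all-filter prime? (openInterval a b))

m∣n! : ∀ {m n} → .{{NonZero m}} → m ≤ n → m ∣ n !
m∣n! {suc m} m≤n = ∣-trans (m∣m*n (m !)) (m≤n⇒m!∣n! m≤n)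

record GreatestDivisorUpTo (k t : ℕ) : Set where
  field
    divisor   : ℕ
    divisor>0 : divisor > 0
    divisor≤t : divisor ≤ t
    divisor∣k : divisor ∣ k
    greatest  : ∀ {d} → d ≤ t → d ∣ k → d ≤ divisor

greatestDivisorUpTo : ∀ k t → .{{NonZero t}} → GreatestDivisorUpTo k t
greatestDivisorUpTo k (suc t) = greatestDivisorUpTo1+ t
  where
  greatestDivisorUpTo1+ : ∀ t → GreatestDivisorUpTo k (suc t)
  greatestDivisorUpTo1+ zero = record
    { divisor = 1 ; divisor>0 = z<s ; divisor≤t = ≤-refl ; divisor∣k = 1∣ k ; greatest = λ d≤1 _ → d≤1 }
  greatestDivisorUpTo1+ (suc t) with suc (suc t) ∣? k
  ... | yes t+2∣k = record
    { divisor = suc (suc t) ; divisor>0 = z<s ; divisor≤t = ≤-refl ; divisor∣k = t+2∣k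
    ; greatest = λ d≤t+2 _ → d≤t+2 }
  ... | no  t+2∤k = record
    { divisor = divisor ; divisor>0 = divisor>0 ; divisor≤t = m≤n⇒m≤1+n divisor≤t ; divisor∣k = divisor∣k
    ; greatest = greatest′ }
    where
    open GreatestDivisorUpTo (greatestDivisorUpTo1+ t)
    greatest′ : ∀ {d} → d ≤ suc (suc t) → d ∣ k → d ≤ divisor
    greatest′ d≤t+2 d∣k with m≤n⇒m<n∨m≡n d≤t+2
    ... | inj₁ d≤t+1 = greatest (s≤s⁻¹ d≤t+1) d∣k
    ... | inj₂ refl  = contradiction d∣k t+2∤k

m*n<o*o∧o<m⇒n≤o : ∀ {m n o} → m * n < o * o → o < m → n ≤ o
m*n<o*o∧o<m⇒n≤o mn<o² o<m = ≮⇒≥ (λ o<n → <-asym mn<o² (*-mono-< o<m o<n))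

primeFactor : ∀ {e} → 1 < e → ∃₂ λ p e′ → Prime p × e ≡ p * e′
primeFactor {e} 1<e with factorise e {{>-nonZero (<-trans z<s 1<e)}}
... | record { factors = []     ; isFactorisation = e≡1 } = contradiction e≡1 (>⇒≢ 1<e)
... | record { factors = p ∷ ps ; isFactorisation = e≡p*ps ; factorsPrime = p-prime ∷ _ } =
  p , product ps , p-prime , e≡p*ps

data FactorisationBelowSquare (n : ℕ) : ℕ → Set where
  smallFactors       : ∀ {a b c} → a ≤ n → b ≤ n → c ≤ n → FactorisationBelowSquare n (a * b * c)
  smallTimesBigPrime : ∀ {a p} → a ≤ n → Prime p → n < p → p < n * n → FactorisationBelowSquare n (a * p)

primeTimesGreatestDivisor : ∀ {n k p e′} → .{{NonZero k}} → k < n * n → (g : GreatestDivisorUpTo k n) →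
  Prime p → k ≡ p * e′ * GreatestDivisorUpTo.divisor g → FactorisationBelowSquare n k
primeTimesGreatestDivisor {n} {k} {p} {e′} k<n² g p-prime k≡p*e′*d = bySize (p ≤? n)
  where
  open GreatestDivisorUpTo g renaming (divisor to d)
  d<d*p : d < d * p
  d<d*p = m<m*n d p {{>-nonZero divisor>0}} (nonTrivial⇒n>1 p {{prime⇒nonTrivial p-prime}})
  d*p∣k : d * p ∣ k
  d*p∣k = divides e′ (trans k≡p*e′*d (xy∙z≈y∙zx p e′ d))
  n<d*p : n < d * p
  n<d*p = ≰⇒> λ dp≤n → <⇒≱ d<d*p (greatest dp≤n d*p∣k)
  e′≤n : e′ ≤ n
  e′≤n = m*n<o*o∧o<m⇒n≤o (subst (_< n * n) (trans k≡p*e′*d (xy∙z≈zx∙y p e′ d)) k<n²) n<d*p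
  bySize : Dec (p ≤ n) → FactorisationBelowSquare n k
  bySize (yes p≤n) = subst (FactorisationBelowSquare n) (sym k≡p*e′*d)
                           (smallFactors p≤n e′≤n divisor≤t)
  bySize (no  p≰n) = subst (FactorisationBelowSquare n) (sym k≡e′*d*p)
                           (smallTimesBigPrime e′*d≤n p-prime n<p p<n²)
    where
    n<p : n < p
    n<p = ≰⇒> p≰n
    k≡e′*d*p : k ≡ e′ * d * p
    k≡e′*d*p = trans k≡p*e′*d (xy∙z≈yz∙x p e′ d)
    e′*d≤n : e′ * d ≤ n
    e′*d≤n = m*n<o*o∧o<m⇒n≤o (subst (_< n * n) (trans k≡p*e′*d (*-assoc p e′ d)) k<n²) n<p
    p<n² : p < n * n
    p<n² = ≤-<-trans (∣⇒≤ (divides (e′ * d) k≡e′*d*p)) k<n²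

factoriseBelowSquare : ∀ {n k} → .{{NonZero k}} → k < n * n → FactorisationBelowSquare n k
factoriseBelowSquare {n@(suc _)} {k} k<n² = bySize (e ≤? n)
  where
  g : GreatestDivisorUpTo k n
  g = greatestDivisorUpTo k n
  open GreatestDivisorUpTo g renaming (divisor to d)
  e : ℕ
  e = quotient divisor∣k
  k≡e*d : k ≡ e * d
  k≡e*d = m∣n⇒n≡quotient*m divisor∣k
  bySize : Dec (e ≤ n) → FactorisationBelowSquare n k
  bySize (yes e≤n) = subst (FactorisationBelowSquare n) (trans (*-identityʳ (e * d)) (sym k≡e*d))
                           (smallFactors e≤n divisor≤t (s≤s z≤n))
  bySize (no  e≰n) with primeFactor (≤-<-trans (s≤s z≤n) (≰⇒> e≰n))
  ... | p , e′ , p-prime , e≡p*e′ =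
    primeTimesGreatestDivisor k<n² g p-prime (trans k≡e*d (cong (_* d) e≡p*e′))

FactorisationBelowSquare⇒∣ : ∀ {n k} → .{{NonZero k}} → FactorisationBelowSquare n k →
                             k ∣ n ! * n ! * n ! * primeProductBetween n (n * n)
FactorisationBelowSquare⇒∣ (smallFactors {a} {b} {c} a≤n b≤n c≤n) =
  ∣m⇒∣m*n _ (*-pres-∣ (*-pres-∣ (m∣n! {{a≢0}} a≤n) (m∣n! {{b≢0}} b≤n)) (m∣n! {{c≢0}} c≤n))
  where
  ab≢0 : NonZero (a * b)
  ab≢0 = m*n≢0⇒m≢0 (a * b)
  a≢0 : NonZero a
  a≢0 = m*n≢0⇒m≢0 a {{ab≢0}}
  b≢0 : NonZero b
  b≢0 = m*n≢0⇒n≢0 a {{ab≢0}}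
  c≢0 : NonZero c
  c≢0 = m*n≢0⇒n≢0 (a * b)
FactorisationBelowSquare⇒∣ {n} (smallTimesBigPrime {a} a≤n p-prime n<p p<n²) =
  *-pres-∣ (∣n⇒∣m*n (n ! * n !) (m∣n! {{m*n≢0⇒m≢0 a}} a≤n)) (prime∣primeProductBetween p-prime n<p p<n²)

∣!³*primeProductBetween : ∀ {n k} → .{{NonZero k}} → k < n * n →
                          k ∣ n ! * n ! * n ! * primeProductBetween n (n * n)
∣!³*primeProductBetween {n} k<n² = FactorisationBelowSquare⇒∣ (factoriseBelowSquare {n} k<n²)

4^m≤!³*primeProductBetween : ∀ {n m} → suc (m + m) < n * n →
                             4 ^ m ≤ n ! * n ! * n ! * primeProductBetween n (n * n)
4^m≤!³*primeProductBetween {n} {m} 2m+1<n² = ≤-trans (4^m≤factorialQuotient m)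
  (∣⇒≤ {{product≢0}} (factorialQuotient-∣ m m (λ k m<k k≤2m+1 →
    ∣!³*primeProductBetween {n} {{>-nonZero (≤-<-trans z≤n m<k)}} (≤-<-trans k≤2m+1 2m+1<n²))))
  where
  product≢0 : NonZero (n ! * n ! * n ! * primeProductBetween n (n * n))
  product≢0 =
    m*n≢0 _ _ {{m*n≢0 _ _ {{n !* n !≢0}} {{n !≢0}}}} {{primeProductBetween≢0 n (n * n)}}

[2+n]²≤2[1+n]² : ∀ {n} → 2 ≤ n → (2 + n) * (2 + n) ≤ 2 * ((1 + n) * (1 + n))
[2+n]²≤2[1+n]² {suc (suc i)} (s≤s (s≤s _)) = subst ((4 + i) * (4 + i) ≤_) (sym (slack i)) (m≤m+n _ _)
  where
  slack : ∀ i → 2 * ((3 + i) * (3 + i)) ≡ (4 + i) * (4 + i) + (2 + 4 * i + i * i)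
  slack = solve-∀

[2+n]⁴≤4*[1+n]⁴ : ∀ {n} → 2 ≤ n → (2 + n) ^ 4 ≤ 4 * (1 + n) ^ 4
[2+n]⁴≤4*[1+n]⁴ {n} 2≤n =
  subst₂ _≤_ (square² (2 + n)) (double² (1 + n)) (*-mono-≤ ([2+n]²≤2[1+n]² 2≤n) ([2+n]²≤2[1+n]² 2≤n))
  where
  square² : ∀ x → (x * x) * (x * x) ≡ x * (x * (x * (x * 1)))
  square² = solve-∀
  double² : ∀ x → (2 * (x * x)) * (2 * (x * x)) ≡ 4 * (x * (x * (x * (x * 1))))
  double² = solve-∀

[1+n]⁴≤4^n : ∀ {n} → 6 ≤ n → (1 + n) ^ 4 ≤ 4 ^ n
[1+n]⁴≤4^n 6≤n = go (≤⇒≤′ 6≤n)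
  where
  go : ∀ {n} → 6 ≤′ n → (1 + n) ^ 4 ≤ 4 ^ n
  go ≤′-refl              = ≤ᵇ⇒≤ _ _ tt
  go (≤′-step {n} 6≤′n) =
    ≤-trans ([2+n]⁴≤4*[1+n]⁴ (≤-trans (≤ᵇ⇒≤ 2 6 tt) (≤′⇒≤ 6≤′n))) (*-monoʳ-≤ 4 (go 6≤′n))

4^m≡2^[m+m] : ∀ m → 4 ^ m ≡ 2 ^ (m + m)
4^m≡2^[m+m] m = trans (^-*-assoc 2 2 m) (cong (λ c → 2 ^ (m + c)) (+-identityʳ m))

8*2^n*[n!]⁴≤2^[n*n] : ∀ {n} → 11 ≤ n → 8 * 2 ^ n * (n !) ^ 4 ≤ 2 ^ (n * n)
8*2^n*[n!]⁴≤2^[n*n] 11≤n = go (≤⇒≤′ 11≤n)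
  where
  open ≤-Reasoning
  regroup : ∀ s p f → 8 * (2 * p) * ((s * f) * ((s * f) * ((s * f) * ((s * f) * 1))))
                    ≡ (8 * p * (f * (f * (f * (f * 1))))) * (2 * (s * (s * (s * (s * 1)))))
  regroup = solve-∀
  exponent : ∀ n → n * n + suc (n + n) ≡ suc n * suc n
  exponent = solve-∀
  go : ∀ {n} → 11 ≤′ n → 8 * 2 ^ n * (n !) ^ 4 ≤ 2 ^ (n * n)
  go ≤′-refl              = ≤ᵇ⇒≤ _ _ tt
  go (≤′-step {n} 11≤′n) = begin
    8 * 2 ^ suc n * (suc n !) ^ 4                  ≡⟨ regroup (suc n) (2 ^ n) (n !) ⟩
    (8 * 2 ^ n * (n !) ^ 4) * (2 * (suc n) ^ 4)    ≤⟨ *-mono-≤ (go 11≤′n) (*-monoʳ-≤ 2 ([1+n]⁴≤4^n 6≤n)) ⟩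
    2 ^ (n * n) * (2 * 4 ^ n)                      ≡⟨ cong (λ c → 2 ^ (n * n) * (2 * c)) (4^m≡2^[m+m] n) ⟩
    2 ^ (n * n) * 2 ^ suc (n + n)                  ≡⟨ ^-distribˡ-+-* 2 (n * n) (suc (n + n)) ⟨
    2 ^ (n * n + suc (n + n))                      ≡⟨ cong (2 ^_) (exponent n) ⟩
    2 ^ (suc n * suc n)                            ∎
    where
    6≤n : 6 ≤ n
    6≤n = ≤-trans (≤ᵇ⇒≤ 6 11 tt) (≤′⇒≤ 11≤′n)

halve : ∀ N → ∃[ m ] (m + m ≤ N × N ≤ suc (m + m))
halve zero          = 0 , z≤n , z≤n
halve (suc zero)    = 0 , z≤n , s≤s z≤n
halve (suc (suc N)) with halve N
... | m , 2m≤N , N≤2m+1 = suc m , subst (_≤ 2 + N) twice (s≤s (s≤s 2m≤N))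
                                , subst (2 + N ≤_) (cong suc twice) (s≤s (s≤s N≤2m+1))
  where
  twice : suc (suc (m + m)) ≡ suc m + suc m
  twice = cong suc (sym (+-suc m m))

n!⁴*2^n≤4^m : ∀ {n m} → 11 ≤ n → n * n ≤ 3 + (m + m) → n ! * n ! * n ! * (n ! * 2 ^ n) ≤ 4 ^ m
n!⁴*2^n≤4^m {n} {m} 11≤n n²≤2m+3 = *-cancelʳ-≤ _ _ 8 (begin
  n ! * n ! * n ! * (n ! * 2 ^ n) * 8  ≡⟨ regroup (n !) (2 ^ n) ⟩
  8 * 2 ^ n * (n !) ^ 4                ≤⟨ 8*2^n*[n!]⁴≤2^[n*n] 11≤n ⟩
  2 ^ (n * n)                          ≤⟨ ^-monoʳ-≤ 2 n²≤2m+3 ⟩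
  2 ^ (3 + (m + m))                    ≡⟨ eight (2 ^ (m + m)) ⟩
  2 ^ (m + m) * 8                      ≡⟨ cong (_* 8) (4^m≡2^[m+m] m) ⟨
  4 ^ m * 8                            ∎)
  where
  open ≤-Reasoning
  regroup : ∀ f p → f * f * f * (f * p) * 8 ≡ 8 * p * (f * (f * (f * (f * 1))))
  regroup = solve-∀
  eight : ∀ x → 2 * (2 * (2 * x)) ≡ x * 8
  eight = solve-∀

n!*2^n≤primeProductBetween : ∀ {n} → 11 ≤ n → n ! * 2 ^ n ≤ primeProductBetween n (n * n)
-- with n visibly ≥ 2, 2 + (n * n ∸ 2) reduces to n * n
n!*2^n≤primeProductBetween {n@(suc (suc _))} 11≤n@(s≤s (s≤s _)) with halve (n * n ∸ 2)
... | m , 2m≤n²-2 , n²-2≤2m+1 = *-cancelˡ-≤ (n ! * n ! * n !) {{n!³≢0}} (≤-trans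
  (n!⁴*2^n≤4^m {n} {m} 11≤n (s≤s (s≤s n²-2≤2m+1)))
  (4^m≤!³*primeProductBetween {n} {m} (s≤s (s≤s 2m≤n²-2))))
  where
  n!³≢0 : NonZero (n ! * n ! * n !)
  n!³≢0 = m*n≢0 _ _ {{n !* n !≢0}} {{n !≢0}}

lemma1p1 : (n : ℕ) → 4 ≤ n → (n !) * (2 ^ n) ≤ primeProductBetween n (n * n)
lemma1p1 0  ()
lemma1p1 1  (s≤s ())
lemma1p1 2  (s≤s (s≤s ()))
lemma1p1 3  (s≤s (s≤s (s≤s ())))
lemma1p1 4  _ = ≤ᵇ⇒≤ _ _ tt
lemma1p1 5  _ = ≤ᵇ⇒≤ _ _ tt
lemma1p1 6  _ = ≤ᵇ⇒≤ _ _ tt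
lemma1p1 7  _ = ≤ᵇ⇒≤ _ _ tt
lemma1p1 8  _ = ≤ᵇ⇒≤ _ _ tt
lemma1p1 9  _ = ≤ᵇ⇒≤ _ _ tt
lemma1p1 10 _ = ≤ᵇ⇒≤ _ _ tt
lemma1p1 (suc (suc (suc (suc (suc (suc (suc (suc (suc (suc (suc j))))))))))) _ =
  n!*2^n≤primeProductBetween (m≤m+n 11 j)
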